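{- Let $G$ be a finite simple graph containing an edge $e=\{a,b\}$ such that $N(a)\setminus\{b\}\supseteq N(b)\setminus\{a\}$, where $N(x)$ denotes the set of neighbors of $x$. Then for any vertex $c\ne b$ such that $e'=\{c,b\}$ is not an edge of $G$, the number of acyclic orientations of $G$ is at most the number of acyclic orientations of the graph $G\setminus e+e'$ obtained by deleting $e$ and adding $e'$.
   Context: An acyclic orientation of a simple graph directs every edge so that there is no directed cycle. -}

module Defs where

open import Data.Nat using (ℕ)
open import Data.Bool using (Bool; true; false; if_then_else_; _∧_; _∨_)
open import Data.Fin using (Fin; _≟_)
open import Data.Vec using (Vec; lookup)
open import Data.Sum using (_⊎_)
open import Data.Product using (∃)
open import Relation.Nullary using (¬_)
open import Relation.Nullary.Decidable using (⌊_⌋)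
open import Relation.Binary.PropositionalEquality using (_≡_)
open import Relation.Binary.Construct.Closure.Transitive using (TransClosure)

record SimpleGraph (n : ℕ) : Set where
  field
    adj    : Fin n → Fin n → Bool
    sym    : ∀ x y → adj x y ≡ adj y x
    irrefl : ∀ x → adj x x ≡ false
open SimpleGraph public

samePair : ∀ {n} → Fin n → Fin n → Fin n → Fin n → Bool
samePair x y u v = (⌊ x ≟ u ⌋ ∧ ⌊ y ≟ v ⌋) ∨ (⌊ x ≟ v ⌋ ∧ ⌊ y ≟ u ⌋)

swapAdj : ∀ {n} → (Fin n → Fin n → Bool) → Fin n → Fin n → Fin n
        → Fin n → Fin n → Bool
swapAdj E a b c x y =
  if samePair x y a b then false
  else (if samePair x y c b then true else E x y)

Arc : ∀ {n} → Vec (Vec Bool n) n → Fin n → Fin n → Set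
Arc D x y = lookup (lookup D x) y ≡ true

HasDirectedCycle : ∀ {n} → Vec (Vec Bool n) n → Set
HasDirectedCycle D = ∃ λ v → TransClosure (Arc D) v v

-- Acyclic orientations of the graph with adjacency E.  Proof fields are
-- irrelevant, so an acyclic orientation is determined by its matrix.
record AcyclicOrientation {n : ℕ} (E : Fin n → Fin n → Bool) : Set where
  field
    dir      : Vec (Vec Bool n) n
    .onEdges : ∀ x y → Arc dir x y → E x y ≡ true
    .covers  : ∀ x y → E x y ≡ true → Arc dir x y ⊎ Arc dir y x
    .antisym : ∀ x y → Arc dir x y → ¬ Arc dir y x
    .acyclic : ¬ HasDirectedCycle dir

-- Let H = G − ab.  An acyclic orientation d of G restricts to an acyclic orientation o of H;
-- call d free if its arc is b → a and o has no path from b to a.  A non-free d is determined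
-- by o, and is sent to o plus c → b, or plus b → c when o already has a path from b to c.
-- A free d is determined by its restriction to G − b, because N(b) ∖ a ⊆ N(a) forces the
-- edges at b to copy those at a.  It is sent to that restriction with the edges at b reoriented
-- so that c and b are incomparable, plus b → c; there b → c is the only path from b to c,
-- so these images are new.  This injects the acyclic orientations of G into those of G − ab + cb.

module Submission where

open import Defs hiding (sym)
open import Data.Nat using (ℕ; _≤_)
open import Data.Bool using (Bool; true; false; _∧_; _∨_; if_then_else_)
import Data.Bool.Properties as Bool
open import Data.Fin using (Fin; _≟_)
open import Data.Fin.Properties using (injective⇒≤)
open import Data.List using (List; []; _∷_; allFin)
open import Data.List.Membership.Propositional using (_∈_)
open import Data.List.Membership.Propositional.Properties using (∈-allFin)
open import Data.List.Relation.Unary.Any using (here; there)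
open import Data.Product using (_×_; _,_; proj₁; proj₂; swap)
open import Data.Sum using (_⊎_; inj₁; inj₂) renaming (map to ⊎-map; map₂ to ⊎-map₂)
open import Data.Empty using (⊥-elim)
open import Data.Empty.Irrelevant renaming (⊥-elim to ⊥-elim-irr)
open import Data.Vec using (Vec; lookup; tabulate)
open import Data.Vec.Properties using (lookup∘tabulate; tabulate∘lookup; tabulate-cong)
open import Function using (_∘_)
open import Function.Bundles using (_↔_; mk↣; mk⇔; Injection)
open import Function.Properties.Inverse using (↔⇒↣; ↔-sym)
open import Function.Construct.Composition using (_↣-∘_)
open import Level using (0ℓ)
open import Relation.Binary.Core using (Rel; _⇒_; _⇔_)
open import Relation.Binary.Definitions using (Decidable)
open import Relation.Binary.Construct.Closure.Transitive using (TransClosure; [_]; _∷_; _++_)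
open import Relation.Nullary using (¬_; Dec; yes; no; does)
open import Relation.Nullary.Decidable using (_×-dec_; _⊎-dec_; ¬?; map′; dec-true; isYes≗does; recompute)
open import Relation.Binary.PropositionalEquality using (_≡_; _≢_; refl; sym; trans; cong; cong₂; subst)

module _ {n : ℕ} where

  Path : Rel (Fin n) 0ℓ → Rel (Fin n) 0ℓ
  Path R = TransClosure R

  Reach : Rel (Fin n) 0ℓ → Rel (Fin n) 0ℓ
  Reach R x y = x ≡ y ⊎ Path R x y

  Acyclic : Rel (Fin n) 0ℓ → Set
  Acyclic R = ∀ {v} → ¬ Path R v v

  Path-mono : ∀ {R S : Rel (Fin n) 0ℓ} → R ⇒ S → Path R ⇒ Path S
  Path-mono R⇒S [ r ]    = [ R⇒S r ]
  Path-mono R⇒S (r ∷ p) = R⇒S r ∷ Path-mono R⇒S p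

  Reach-Path : ∀ {R : Rel (Fin n) 0ℓ} {x y z} → Reach R x y → Path R y z → Path R x z
  Reach-Path (inj₁ refl) q = q
  Reach-Path (inj₂ p)    q = p ++ q

  Path-Reach : ∀ {R : Rel (Fin n) 0ℓ} {x y z} → Path R x y → Reach R y z → Path R x z
  Path-Reach p (inj₁ refl) = p
  Path-Reach p (inj₂ q)    = p ++ q

  Reach-trans : ∀ {R : Rel (Fin n) 0ℓ} {x y z} → Reach R x y → Reach R y z → Reach R x z
  Reach-trans (inj₁ refl) q = q
  Reach-trans (inj₂ p)    q = inj₂ (Path-Reach p q)

  Acyclic-mono : ∀ {R S : Rel (Fin n) 0ℓ} → R ⇒ S → Acyclic S → Acyclic R
  Acyclic-mono R⇒S acyclic = acyclic ∘ Path-mono R⇒S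

  -- Floyd–Warshall: a path whose intermediate vertices lie in w ∷ S either avoids w
  -- or splits at w into two paths with intermediate vertices in S.
  module _ {R : Rel (Fin n) 0ℓ} (R? : Decidable R) where

    private
      data PathVia (S : List (Fin n)) : Rel (Fin n) 0ℓ where
        [_] : ∀ {x y} → R x y → PathVia S x y
        _∷_ : ∀ {x z y} → R x z × z ∈ S → PathVia S z y → PathVia S x y

      weaken : ∀ {w S x y} → PathVia S x y → PathVia (w ∷ S) x y
      weaken [ r ]             = [ r ]
      weaken ((r , z∈S) ∷ p) = (r , there z∈S) ∷ weaken p

      join : ∀ {S x z y} → PathVia S x z → z ∈ S → PathVia S z y → PathVia S x y
      join [ r ]        z∈S q = (r , z∈S) ∷ q
      join (rz ∷ p)     z∈S q = rz ∷ join p z∈S q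

      split : ∀ {w S x y} → PathVia (w ∷ S) x y → PathVia S x y ⊎ (PathVia S x w × PathVia S w y)
      split [ r ] = inj₁ [ r ]
      split ((r , here refl) ∷ p) with split p
      ... | inj₁ q       = inj₂ ([ r ] , q)
      ... | inj₂ (_ , q) = inj₂ ([ r ] , q)
      split ((r , there z∈S) ∷ p) with split p
      ... | inj₁ q        = inj₁ ((r , z∈S) ∷ q)
      ... | inj₂ (q , q′) = inj₂ ((r , z∈S) ∷ q , q′)

      merge : ∀ {w S x y} → PathVia S x y ⊎ (PathVia S x w × PathVia S w y) → PathVia (w ∷ S) x y
      merge (inj₁ p)       = weaken p
      merge (inj₂ (p , q)) = join (weaken p) (here refl) (weaken q)

      via? : ∀ S → Decidable (PathVia S)
      via? []      x y = map′ [_] (λ { [ r ] → r ; ((_ , ()) ∷ _) }) (R? x y)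
      via? (w ∷ S) x y = map′ merge split (via? S x y ⊎-dec (via? S x w ×-dec via? S w y))

      fromVia : ∀ {S x y} → PathVia S x y → Path R x y
      fromVia [ r ]        = [ r ]
      fromVia ((r , _) ∷ p) = r ∷ fromVia p

      toVia : ∀ {x y} → Path R x y → PathVia (allFin n) x y
      toVia [ r ]              = [ r ]
      toVia (_∷_ {y = z} r p) = (r , ∈-allFin z) ∷ toVia p

    Path? : Decidable (Path R)
    Path? x y = map′ fromVia toVia (via? (allFin n) x y)

    Reach? : Decidable (Reach R)
    Reach? x y = (x ≟ y) ⊎-dec Path? x y

  Pair : Fin n → Fin n → Rel (Fin n) 0ℓ
  Pair u v x y = (x ≡ u × y ≡ v) ⊎ (x ≡ v × y ≡ u)

  Pair-sym : ∀ {u v x y} → Pair u v x y → Pair u v y x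
  Pair-sym (inj₁ (x≡u , y≡v)) = inj₂ (y≡v , x≡u)
  Pair-sym (inj₂ (x≡v , y≡u)) = inj₁ (y≡u , x≡v)

  Pair-comm : ∀ {u v x y} → Pair u v x y → Pair v u x y
  Pair-comm (inj₁ p) = inj₂ p
  Pair-comm (inj₂ p) = inj₁ p

  Pair? : ∀ u v → Decidable (Pair u v)
  Pair? u v x y = ((x ≟ u) ×-dec (y ≟ v)) ⊎-dec ((x ≟ v) ×-dec (y ≟ u))

  samePair≡ : (x y u v : Fin n) → samePair x y u v ≡ does (Pair? u v x y)
  samePair≡ x y u v = cong₂ _∨_ (cong₂ _∧_ (isYes≗does (x ≟ u)) (isYes≗does (y ≟ v)))
                                (cong₂ _∧_ (isYes≗does (x ≟ v)) (isYes≗does (y ≟ u)))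

  removePair : Fin n → Fin n → Rel (Fin n) 0ℓ → Rel (Fin n) 0ℓ
  removePair u v R x y = R x y × ¬ Pair u v x y

  addPair : Fin n → Fin n → Rel (Fin n) 0ℓ → Rel (Fin n) 0ℓ
  addPair u v K x y = K x y ⊎ Pair u v x y

  addArc : Fin n → Fin n → Rel (Fin n) 0ℓ → Rel (Fin n) 0ℓ
  addArc u v R x y = R x y ⊎ (x ≡ u × y ≡ v)

  deleteVertex : Fin n → Rel (Fin n) 0ℓ → Rel (Fin n) 0ℓ
  deleteVertex b R x y = x ≢ b × y ≢ b × R x y

  addPair-comm : ∀ {K u v} → addPair u v K ⇔ addPair v u K
  addPair-comm = ⊎-map₂ Pair-comm , ⊎-map₂ Pair-comm

  deleteVertex-mono : ∀ {R S : Rel (Fin n) 0ℓ} {v} → R ⇒ S → deleteVertex v R ⇒ deleteVertex v S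
  deleteVertex-mono R⇒S (x≢v , y≢v , r) = x≢v , y≢v , R⇒S r

  Path-end : ∀ {R : Rel (Fin n) 0ℓ} {b x y} → Path (deleteVertex b R) x y → y ≢ b
  Path-end [ _ , y≢b , _ ] = y≢b
  Path-end (_ ∷ p)         = Path-end p

  Path-start : ∀ {R : Rel (Fin n) 0ℓ} {b x y} → Path (deleteVertex b R) x y → x ≢ b
  Path-start [ x≢b , _ ]      = x≢b
  Path-start ((x≢b , _) ∷ _) = x≢b

  module _ {R : Rel (Fin n) 0ℓ} (R? : Decidable R) where

    removePair? : ∀ u v → Decidable (removePair u v R)
    removePair? u v x y = R? x y ×-dec ¬? (Pair? u v x y)

    addArc? : ∀ u v → Decidable (addArc u v R)
    addArc? u v x y = R? x y ⊎-dec ((x ≟ u) ×-dec (y ≟ v))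

    deleteVertex? : ∀ b → Decidable (deleteVertex b R)
    deleteVertex? b x y = ¬? (x ≟ b) ×-dec ¬? (y ≟ b) ×-dec R? x y

  record IsOrientation (K R : Rel (Fin n) 0ℓ) : Set where
    field
      arc⇒edge : R ⇒ K
      edge⇒arc : ∀ {x y} → K x y → R x y ⊎ R y x
      asym     : ∀ {x y} → R x y → ¬ R y x

  record AcyclicArcs (K : Rel (Fin n) 0ℓ) : Set₁ where
    field
      arc           : Rel (Fin n) 0ℓ
      arc?          : Decidable arc
      isOrientation : IsOrientation K arc
      acyclic       : Acyclic arc
    open IsOrientation isOrientation public

  module _ {K R : Rel (Fin n) 0ℓ} (O : IsOrientation K R) where
    open IsOrientation O

    IsOrientation-resp : ∀ {K′} → K ⇔ K′ → IsOrientation K′ R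
    IsOrientation-resp (K⇒K′ , K′⇒K) = record
      { arc⇒edge = K⇒K′ ∘ arc⇒edge ; edge⇒arc = edge⇒arc ∘ K′⇒K ; asym = asym }

    removePair-isOrientation : ∀ u v → IsOrientation (removePair u v K) (removePair u v R)
    removePair-isOrientation u v = record
      { arc⇒edge = λ (r , ¬uv) → arc⇒edge r , ¬uv
      ; edge⇒arc = λ { (k , ¬uv) → ⊎-map (_, ¬uv) (_, ¬uv ∘ Pair-sym) (edge⇒arc k) }
      ; asym     = λ (r , _) (r′ , _) → asym r r′ }

    addArc-isOrientation : ∀ {u v} → u ≢ v → (∀ {x y} → Pair u v x y → ¬ K x y)
                         → IsOrientation (addPair u v K) (addArc u v R)
    addArc-isOrientation {u} {v} u≢v fresh = record
      { arc⇒edge = λ { (inj₁ r) → inj₁ (arc⇒edge r) ; (inj₂ uv) → inj₂ (inj₁ uv) }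
      ; edge⇒arc = edge⇒addArc
      ; asym     = asym′ }
      where
        edge⇒addArc : ∀ {x y} → addPair u v K x y → addArc u v R x y ⊎ addArc u v R y x
        edge⇒addArc (inj₁ k)                 = ⊎-map inj₁ inj₁ (edge⇒arc k)
        edge⇒addArc (inj₂ (inj₁ uv))         = inj₁ (inj₂ uv)
        edge⇒addArc (inj₂ (inj₂ (x≡v , y≡u))) = inj₂ (inj₂ (y≡u , x≡v))

        asym′ : ∀ {x y} → addArc u v R x y → ¬ addArc u v R y x
        asym′ (inj₁ r)             (inj₁ r′)            = asym r r′
        asym′ (inj₁ r)             (inj₂ (refl , refl)) = fresh (inj₂ (refl , refl)) (arc⇒edge r)
        asym′ (inj₂ (refl , refl)) (inj₁ r′)            = fresh (inj₂ (refl , refl)) (arc⇒edge r′)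
        asym′ (inj₂ (refl , refl)) (inj₂ (refl , _))    = u≢v refl

    reversed-arc : ∀ {R′ x y} → IsOrientation K R′ → (R x y → R′ x y) → R′ y x → R y x
    reversed-arc O′ R⇒R′ r′ with edge⇒arc (IsOrientation.arc⇒edge O′ r′)
    ... | inj₁ r = r
    ... | inj₂ r = ⊥-elim (IsOrientation.asym O′ (R⇒R′ r) r′)

  module _ {K R₁ R₂ : Rel (Fin n) 0ℓ} (O₁ : IsOrientation K R₁) (O₂ : IsOrientation K R₂) where

    ⇒-from-pair : ∀ {u v} → removePair u v R₁ ⇒ removePair u v R₂
                → (R₁ u v → R₂ u v) → (R₂ u v → R₁ u v) → R₁ ⇒ R₂
    ⇒-from-pair {u} {v} off uv₁₂ uv₂₁ {x} {y} r with Pair? u v x y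
    ... | yes (inj₁ (refl , refl)) = uv₁₂ r
    ... | yes (inj₂ (refl , refl)) = reversed-arc O₂ O₁ uv₂₁ r
    ... | no ¬uv                   = proj₁ (off (r , ¬uv))

    ⇒-from-vertex : ∀ {b} → deleteVertex b R₁ ⇒ deleteVertex b R₂
                  → (∀ {y} → R₁ b y → R₂ b y) → (∀ {y} → R₂ b y → R₁ b y) → R₁ ⇒ R₂
    ⇒-from-vertex {b} off row₁₂ row₂₁ {x} {y} r with x ≟ b | y ≟ b
    ... | yes refl | _        = row₁₂ r
    ... | no _     | yes refl = reversed-arc O₂ O₁ row₂₁ r
    ... | no x≢b   | no y≢b   = proj₂ (proj₂ (off (x≢b , y≢b , r)))

  agree-off-pair : ∀ {K R₁ R₂ : Rel (Fin n) 0ℓ} {u v} → IsOrientation K R₁ → IsOrientation K R₂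
                 → removePair u v R₁ ⇔ removePair u v R₂ → (R₁ u v → R₂ u v) → (R₂ u v → R₁ u v)
                 → R₁ ⇔ R₂
  agree-off-pair O₁ O₂ (off₁₂ , off₂₁) uv₁₂ uv₂₁ =
    ⇒-from-pair O₁ O₂ off₁₂ uv₁₂ uv₂₁ , ⇒-from-pair O₂ O₁ off₂₁ uv₂₁ uv₁₂

  agree-off-vertex : ∀ {K R₁ R₂ : Rel (Fin n) 0ℓ} {b} → IsOrientation K R₁ → IsOrientation K R₂
                   → deleteVertex b R₁ ⇔ deleteVertex b R₂
                   → (∀ {y} → R₁ b y → R₂ b y) → (∀ {y} → R₂ b y → R₁ b y)
                   → R₁ ⇔ R₂
  agree-off-vertex O₁ O₂ (off₁₂ , off₂₁) row₁₂ row₂₁ =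
    ⇒-from-vertex O₁ O₂ off₁₂ row₁₂ row₂₁ , ⇒-from-vertex O₂ O₁ off₂₁ row₂₁ row₁₂

  module _ {R : Rel (Fin n) 0ℓ} {u v : Fin n} where

    Path-addArc : ∀ {x y} → Path (addArc u v R) x y → Path R x y ⊎ (Reach R x u × Reach R v y)
    Path-addArc [ inj₁ r ]            = inj₁ [ r ]
    Path-addArc [ inj₂ (refl , refl) ] = inj₂ (inj₁ refl , inj₁ refl)
    Path-addArc (inj₁ r ∷ p) with Path-addArc p
    ... | inj₁ q           = inj₁ (r ∷ q)
    ... | inj₂ (zu , vy)   = inj₂ (inj₂ (Path-Reach [ r ] zu) , vy)
    Path-addArc (inj₂ (refl , refl) ∷ p) with Path-addArc p
    ... | inj₁ q           = inj₂ (inj₁ refl , inj₂ q)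
    ... | inj₂ (_ , vy)    = inj₂ (inj₁ refl , vy)

    addArc-acyclic : Acyclic R → u ≢ v → ¬ Path R v u → Acyclic (addArc u v R)
    addArc-acyclic acyclic u≢v ¬vu p with Path-addArc p
    ... | inj₁ q        = acyclic q
    ... | inj₂ (wu , vw) with Reach-trans vw wu
    ...   | inj₁ v≡u = u≢v (sym v≡u)
    ...   | inj₂ q   = ¬vu q

    addArc-cancel : ∀ {R′} → ¬ R u v → addArc u v R ⇒ addArc u v R′ → R ⇒ R′
    addArc-cancel ¬uv incl r with incl (inj₁ r)
    ... | inj₁ r′           = r′
    ... | inj₂ (refl , refl) = ⊥-elim (¬uv r)

    addArc-reversed : ∀ {R′} → u ≢ v → ¬ R′ u v → ¬ (addArc u v R ⇒ addArc v u R′)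
    addArc-reversed u≢v ¬uv incl with incl (inj₂ (refl , refl))
    ... | inj₁ r′          = ¬uv r′
    ... | inj₂ (u≡v , _)   = u≢v u≡v

  AcyclicArcs-resp : ∀ {K K′} → K ⇔ K′ → AcyclicArcs K → AcyclicArcs K′
  AcyclicArcs-resp K⇔K′ O = record
    { arc           = arc
    ; arc?          = arc?
    ; isOrientation = IsOrientation-resp isOrientation K⇔K′
    ; acyclic       = acyclic }
    where open AcyclicArcs O

  removePairᴬ : ∀ {K} → AcyclicArcs K → ∀ u v → AcyclicArcs (removePair u v K)
  removePairᴬ O u v = record
    { arc           = removePair u v arc
    ; arc?          = removePair? arc? u v
    ; isOrientation = removePair-isOrientation isOrientation u v
    ; acyclic       = Acyclic-mono proj₁ acyclic }
    where open AcyclicArcs O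

  addArcᴬ : ∀ {K} (O : AcyclicArcs K) {u v} → u ≢ v → (∀ {x y} → Pair u v x y → ¬ K x y)
          → ¬ Path (AcyclicArcs.arc O) v u → AcyclicArcs (addPair u v K)
  addArcᴬ O {u} {v} u≢v fresh ¬vu = record
    { arc           = addArc u v arc
    ; arc?          = addArc? arc? u v
    ; isOrientation = addArc-isOrientation isOrientation u≢v fresh
    ; acyclic       = addArc-acyclic acyclic u≢v ¬vu }
    where open AcyclicArcs O

  -- Reorient the edges at b: b → y if y is reachable from c in R − b, y → b otherwise.
  -- No arc leaves the set reachable from c, so c and b become incomparable.
  module Reroute {K R : Rel (Fin n) 0ℓ} (K? : Decidable K) (R? : Decidable R) (b c : Fin n) where

    Downstream : Fin n → Set
    Downstream = Reach (deleteVertex b R) c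

    Downstream? : ∀ y → Dec (Downstream y)
    Downstream? = Reach? (deleteVertex? R? b) c

    reroute : Rel (Fin n) 0ℓ
    reroute x y = deleteVertex b R x y
                ⊎ (x ≡ b × K b y × Downstream y)
                ⊎ (y ≡ b × K x b × ¬ Downstream x)

    reroute? : Decidable reroute
    reroute? x y = deleteVertex? R? b x y
                 ⊎-dec ((x ≟ b) ×-dec K? b y ×-dec Downstream? y)
                 ⊎-dec ((y ≟ b) ×-dec K? x b ×-dec ¬? (Downstream? x))

    deleteVertex-reroute : deleteVertex b reroute ⇔ deleteVertex b R
    deleteVertex-reroute = to , λ (x≢b , y≢b , r) → x≢b , y≢b , inj₁ (x≢b , y≢b , r)
      where
        to : deleteVertex b reroute ⇒ deleteVertex b R
        to (_ , _ , inj₁ r)                     = r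
        to (x≢b , _ , inj₂ (inj₁ (x≡b , _)))   = ⊥-elim (x≢b x≡b)
        to (_ , y≢b , inj₂ (inj₂ (y≡b , _)))   = ⊥-elim (y≢b y≡b)

    module Properties (O : IsOrientation K R) (acyclic : Acyclic R)
             (K-sym : ∀ {x y} → K x y → K y x) (K-irrefl : ∀ {x} → ¬ K x x)
             (c≢b : c ≢ b) (¬Kbc : ¬ K b c) where
      open IsOrientation O

      ¬Downstream-b : ¬ Downstream b
      ¬Downstream-b (inj₁ c≡b) = c≢b c≡b
      ¬Downstream-b (inj₂ p)   = Path-end p refl

      Downstream-step : ∀ {x y} → Downstream x → deleteVertex b R x y → Downstream y
      Downstream-step d r = inj₂ (Reach-Path d [ r ])

      Downstream-arc : ∀ {x y} → Downstream x → reroute x y → deleteVertex b R x y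
      Downstream-arc d (inj₁ r)                      = r
      Downstream-arc d (inj₂ (inj₁ (refl , _)))      = ⊥-elim (¬Downstream-b d)
      Downstream-arc d (inj₂ (inj₂ (_ , _ , ¬d)))    = ⊥-elim (¬d d)

      Downstream-path : ∀ {x y} → Downstream x → Path reroute x y → Path (deleteVertex b R) x y
      Downstream-path d [ r ]   = [ Downstream-arc d r ]
      Downstream-path d (r ∷ p) = let r′ = Downstream-arc d r in r′ ∷ Downstream-path (Downstream-step d r′) p

      Path-reroute : ∀ {x y} → Path reroute x y → Path (deleteVertex b R) x y ⊎ (Downstream y ⊎ y ≡ b)
      Path-reroute [ inj₁ r ]                        = inj₁ [ r ]
      Path-reroute [ inj₂ (inj₁ (_ , _ , d)) ]       = inj₂ (inj₁ d)
      Path-reroute [ inj₂ (inj₂ (y≡b , _)) ]         = inj₂ (inj₂ y≡b)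
      Path-reroute (r ∷ p) with Path-reroute p
      ... | inj₂ end = inj₂ end
      ... | inj₁ q with r
      ...   | inj₁ r′                     = inj₁ (r′ ∷ q)
      ...   | inj₂ (inj₁ (_ , _ , d))     = inj₂ (inj₁ (Reach-trans d (inj₂ q)))
      ...   | inj₂ (inj₂ (refl , _))      = ⊥-elim (Path-start q refl)

      reroute-isOrientation : IsOrientation K reroute
      reroute-isOrientation = record { arc⇒edge = arc⇒edge′ ; edge⇒arc = edge⇒arc′ ; asym = asym′ }
        where
          arc⇒edge′ : reroute ⇒ K
          arc⇒edge′ (inj₁ (_ , _ , r))             = arc⇒edge r
          arc⇒edge′ (inj₂ (inj₁ (refl , k , _)))   = k
          arc⇒edge′ (inj₂ (inj₂ (refl , k , _)))   = k

          edge⇒arc′ : ∀ {x y} → K x y → reroute x y ⊎ reroute y x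
          edge⇒arc′ {x} {y} k with x ≟ b | y ≟ b
          ... | yes refl | _ with Downstream? y
          ...   | yes d = inj₁ (inj₂ (inj₁ (refl , k , d)))
          ...   | no ¬d = inj₂ (inj₂ (inj₂ (refl , K-sym k , ¬d)))
          edge⇒arc′ {x} {y} k | no x≢b | yes refl with Downstream? x
          ...   | yes d = inj₂ (inj₂ (inj₁ (refl , K-sym k , d)))
          ...   | no ¬d = inj₁ (inj₂ (inj₂ (refl , k , ¬d)))
          edge⇒arc′ {x} {y} k | no x≢b | no y≢b =
            ⊎-map (λ r → inj₁ (x≢b , y≢b , r)) (λ r → inj₁ (y≢b , x≢b , r)) (edge⇒arc k)

          asym′ : ∀ {x y} → reroute x y → ¬ reroute y x
          asym′ (inj₁ (_ , _ , r))             (inj₁ (_ , _ , r′))            = asym r r′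
          asym′ (inj₁ (_ , y≢b , _))           (inj₂ (inj₁ (y≡b , _)))       = y≢b y≡b
          asym′ (inj₁ (x≢b , _ , _))           (inj₂ (inj₂ (x≡b , _)))       = x≢b x≡b
          asym′ (inj₂ (inj₁ (x≡b , _)))        (inj₁ (_ , x≢b , _))          = x≢b x≡b
          asym′ (inj₂ (inj₂ (y≡b , _)))        (inj₁ (y≢b , _ , _))          = y≢b y≡b
          asym′ (inj₂ (inj₁ (_ , _ , d)))      (inj₂ (inj₁ (refl , _)))      = ¬Downstream-b d
          asym′ (inj₂ (inj₁ (_ , _ , d)))      (inj₂ (inj₂ (_ , _ , ¬d)))    = ¬d d
          asym′ (inj₂ (inj₂ (_ , _ , ¬d)))     (inj₂ (inj₁ (_ , _ , d)))     = ¬d d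
          asym′ (inj₂ (inj₂ (refl , k , _)))   (inj₂ (inj₂ (refl , _)))      = K-irrefl k

      arc-from-b : ∀ {y} → reroute b y → K b y × Downstream y
      arc-from-b (inj₁ (b≢b , _))            = ⊥-elim (b≢b refl)
      arc-from-b (inj₂ (inj₁ (_ , k , d)))   = k , d
      arc-from-b (inj₂ (inj₂ (refl , k , _))) = ⊥-elim (K-irrefl k)

      Path-from-b : ∀ {y} → Path reroute b y → Downstream y
      Path-from-b [ r ]   = proj₂ (arc-from-b r)
      Path-from-b (r ∷ p) = let d = proj₂ (arc-from-b r) in Reach-trans d (inj₂ (Downstream-path d p))

      reroute-acyclic : Acyclic reroute
      reroute-acyclic p with Path-reroute p
      ... | inj₁ q           = acyclic (Path-mono (proj₂ ∘ proj₂) q)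
      ... | inj₂ (inj₁ d)    = acyclic (Path-mono (proj₂ ∘ proj₂) (Downstream-path d p))
      ... | inj₂ (inj₂ refl) = ¬Downstream-b (Path-from-b p)

      ¬Path-c-b : ¬ Path reroute c b
      ¬Path-c-b p = Path-end (Downstream-path (inj₁ refl) p) refl

      ¬Path-b-c : ¬ Path reroute b c
      ¬Path-b-c [ r ]   = ¬Kbc (proj₁ (arc-from-b r))
      ¬Path-b-c (r ∷ p) = let d = proj₂ (arc-from-b r) in
        acyclic (Path-mono (proj₂ ∘ proj₂) (Reach-Path d (Downstream-path d p)))

  rerouteᴬ : ∀ {K} (K? : Decidable K) (O : AcyclicArcs K) (b c : Fin n)
           → (∀ {x y} → K x y → K y x) → (∀ {x} → ¬ K x x) → c ≢ b → ¬ K b c → AcyclicArcs K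
  rerouteᴬ K? O b c K-sym K-irrefl c≢b ¬Kbc = record
    { arc           = reroute
    ; arc?          = reroute?
    ; isOrientation = reroute-isOrientation
    ; acyclic       = reroute-acyclic }
    where open AcyclicArcs O
          open Reroute K? arc? b c
          open Properties isOrientation acyclic K-sym K-irrefl c≢b ¬Kbc

  Edge : (Fin n → Fin n → Bool) → Rel (Fin n) 0ℓ
  Edge E x y = E x y ≡ true

  Edge? : ∀ E → Decidable (Edge E)
  Edge? E x y = E x y Bool.≟ true

  Arc? : ∀ d → Decidable (Arc {n} d)
  Arc? d x y = lookup (lookup d x) y Bool.≟ true

  matrix : ∀ {R : Rel (Fin n) 0ℓ} → Decidable R → Vec (Vec Bool n) n
  matrix R? = tabulate λ x → tabulate λ y → does (R? x y)

  module _ {R : Rel (Fin n) 0ℓ} (R? : Decidable R) {x y : Fin n} where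

    private
      lookup-matrix : lookup (lookup (matrix R?) x) y ≡ does (R? x y)
      lookup-matrix = trans (cong (λ row → lookup row y) (lookup∘tabulate _ x)) (lookup∘tabulate _ y)

    Arc-matrix⁻ : Arc (matrix R?) x y → R x y
    Arc-matrix⁻ r with R? x y | trans (sym lookup-matrix) r
    ... | yes r′ | _ = r′

    Arc-matrix⁺ : R x y → Arc (matrix R?) x y
    Arc-matrix⁺ r = trans lookup-matrix (dec-true (R? x y) r)

  matrix-⇒ : ∀ {R S : Rel (Fin n) 0ℓ} (R? : Decidable R) (S? : Decidable S) → matrix R? ≡ matrix S? → R ⇒ S
  matrix-⇒ R? S? eq {x} {y} r = Arc-matrix⁻ S? (subst (λ d → Arc d x y) eq (Arc-matrix⁺ R? r))

  Vec-ext : ∀ {A : Set} {m} {v w : Vec A m} → (∀ i → lookup v i ≡ lookup w i) → v ≡ w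
  Vec-ext {v = v} {w} eq = trans (sym (tabulate∘lookup v)) (trans (tabulate-cong eq) (tabulate∘lookup w))

  module _ {E : Fin n → Fin n → Bool} where
    open AcyclicOrientation using (dir)

    arcs : AcyclicOrientation E → AcyclicArcs (Edge E)
    arcs record { dir = d ; onEdges = onEdges ; covers = covers ; antisym = antisym ; acyclic = acyclic } = record
      { arc           = Arc d
      ; arc?          = Arc? d
      ; isOrientation = record
        { arc⇒edge = λ {x} {y} r → recompute (Edge? E x y) (onEdges x y r)
        ; edge⇒arc = λ {x} {y} e → recompute (Arc? d x y ⊎-dec Arc? d y x) (covers x y e)
        ; asym     = λ {x} {y} r r′ → ⊥-elim-irr (antisym x y r r′) }
      ; acyclic       = λ {v} p → ⊥-elim-irr (acyclic (v , p)) }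

    fromArcs : AcyclicArcs (Edge E) → AcyclicOrientation E
    fromArcs O = record
      { dir      = matrix arc?
      ; onEdges  = λ x y → arc⇒edge ∘ Arc-matrix⁻ arc?
      ; covers   = λ x y e → ⊎-map (Arc-matrix⁺ arc?) (Arc-matrix⁺ arc?) (edge⇒arc e)
      ; antisym  = λ x y r r′ → asym (Arc-matrix⁻ arc? r) (Arc-matrix⁻ arc? r′)
      ; acyclic  = λ (v , p) → acyclic (Path-mono (Arc-matrix⁻ arc?) p) }
      where open AcyclicArcs O

    dir-injective : ∀ {D₁ D₂ : AcyclicOrientation E} → dir D₁ ≡ dir D₂ → D₁ ≡ D₂
    dir-injective {record { dir = d }} {record { dir = .d }} refl = refl

    AcyclicOrientation-≡ : ∀ {D₁ D₂ : AcyclicOrientation E} → Arc (dir D₁) ⇔ Arc (dir D₂) → D₁ ≡ D₂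
    AcyclicOrientation-≡ (to , from) =
      dir-injective (Vec-ext λ x → Vec-ext λ y → Bool.⇔→≡ (mk⇔ to from))

    fromArcs-injective : ∀ {O₁ O₂ : AcyclicArcs (Edge E)} → fromArcs O₁ ≡ fromArcs O₂
                       → AcyclicArcs.arc O₁ ⇔ AcyclicArcs.arc O₂
    fromArcs-injective {O₁} {O₂} eq = matrix-⇒ arc?₁ arc?₂ (cong dir eq) , matrix-⇒ arc?₂ arc?₁ (cong dir (sym eq))
      where open AcyclicArcs O₁ using () renaming (arc? to arc?₁)
            open AcyclicArcs O₂ using () renaming (arc? to arc?₂)

module EdgeSwap {n} (G : SimpleGraph n) (a b c : Fin n)
                (ab∈G : adj G a b ≡ true)
                (N[b]⊆N[a] : ∀ x → x ≢ a → adj G b x ≡ true → adj G a x ≡ true)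
                (c≢b : c ≢ b) (cb∉G : adj G c b ≡ false) where

  K : Rel (Fin n) 0ℓ
  K = Edge (adj G)

  K-sym : ∀ {x y} → K x y → K y x
  K-sym {x} {y} e = trans (SimpleGraph.sym G y x) e

  K-irrefl : ∀ {x} → ¬ K x x
  K-irrefl {x} e with trans (sym e) (SimpleGraph.irrefl G x)
  ... | ()

  ¬K-cb : ¬ K c b
  ¬K-cb e with trans (sym e) cb∉G
  ... | ()

  a≢b : a ≢ b
  a≢b refl = K-irrefl ab∈G

  a≢c : a ≢ c
  a≢c refl = ¬K-cb ab∈G

  b≢c : b ≢ c
  b≢c = c≢b ∘ sym

  H : Rel (Fin n) 0ℓ
  H = removePair a b K

  H? : Decidable H
  H? = removePair? (Edge? (adj G)) a b

  ¬H-cb : ∀ {x y} → Pair c b x y → ¬ H x y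
  ¬H-cb (inj₁ (refl , refl)) (k , _) = ¬K-cb k
  ¬H-cb (inj₂ (refl , refl)) (k , _) = ¬K-cb (K-sym k)

  swapAdj-edges : Edge (swapAdj (adj G) a b c) ⇔ addPair c b H
  swapAdj-edges = (λ {x} {y} e → to (Pair? a b x y) (Pair? c b x y) (trans (sym (swapAdj-if x y)) e))
                , (λ {x} {y} h → trans (swapAdj-if x y) (from (Pair? a b x y) (Pair? c b x y) h))
    where
      ifPairs : ∀ {x y} → Dec (Pair a b x y) → Dec (Pair c b x y) → Bool
      ifPairs {x} {y} ab? cb? = if does ab? then false else if does cb? then true else adj G x y

      swapAdj-if : ∀ x y → swapAdj (adj G) a b c x y ≡ ifPairs {x} {y} (Pair? a b x y) (Pair? c b x y)
      swapAdj-if x y = cong₂ (λ p q → if p then false else if q then true else adj G x y)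
                             (samePair≡ x y a b) (samePair≡ x y c b)

      to : ∀ {x y} (ab? : Dec (Pair a b x y)) (cb? : Dec (Pair c b x y))
         → ifPairs ab? cb? ≡ true → addPair c b H x y
      to (no ¬ab) (yes cb) _ = inj₂ cb
      to (no ¬ab) (no _)   e = inj₁ (e , ¬ab)

      from : ∀ {x y} (ab? : Dec (Pair a b x y)) (cb? : Dec (Pair c b x y))
           → addPair c b H x y → ifPairs ab? cb? ≡ true
      from (yes ab)                   _        (inj₁ (_ , ¬ab))         = ⊥-elim (¬ab ab)
      from (yes (inj₁ (refl , _)))    _        (inj₂ (inj₁ (a≡c , _))) = ⊥-elim (a≢c a≡c)
      from (yes (inj₁ (refl , _)))    _        (inj₂ (inj₂ (a≡b , _))) = ⊥-elim (a≢b a≡b)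
      from (yes (inj₂ (refl , refl))) _        (inj₂ (inj₁ (b≡c , _))) = ⊥-elim (b≢c b≡c)
      from (yes (inj₂ (refl , refl))) _        (inj₂ (inj₂ (_ , a≡c))) = ⊥-elim (a≢c a≡c)
      from (no _)                     (yes _)  _                       = refl
      from (no _)                     (no _)   (inj₁ (e , _))          = e
      from (no _)                     (no ¬cb) (inj₂ cb)               = ⊥-elim (¬cb cb)

  H-sym : ∀ {x y} → H x y → H y x
  H-sym (k , ¬ab) = K-sym k , ¬ab ∘ Pair-sym

  H-irrefl : ∀ {x} → ¬ H x x
  H-irrefl (k , _) = K-irrefl k

  ¬H-bc : ¬ H b c
  ¬H-bc = ¬H-cb (inj₂ (refl , refl))

  module Extension (D : AcyclicArcs K) where
    open AcyclicArcs D renaming (arc to d; arc? to d?)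

    O : AcyclicArcs H
    O = removePairᴬ D a b

    open AcyclicArcs O public using () renaming (arc to o; arc? to o?; acyclic to o-acyclic)

    -- The arc b → a of a free d can be reversed without creating a cycle.
    Free : Set
    Free = d b a × ¬ Path o b a

    Free? : Dec Free
    Free? = d? b a ×-dec ¬? (Path? o? b a)

    module R = Reroute H? o? b c

    Rerouted : AcyclicArcs H
    Rerouted = rerouteᴬ H? O b c H-sym H-irrefl c≢b ¬H-bc

    open R.Properties (AcyclicArcs.isOrientation O) o-acyclic H-sym H-irrefl c≢b ¬H-bc public
      using (¬Path-c-b; ¬Path-b-c)

    image : Dec Free → Dec (Path o b c) → AcyclicArcs (addPair c b H)
    image (yes _) _      = AcyclicArcs-resp addPair-comm (addArcᴬ Rerouted b≢c (¬H-cb ∘ Pair-comm) ¬Path-c-b)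
    image (no _) (yes bc) = AcyclicArcs-resp addPair-comm (addArcᴬ O b≢c (¬H-cb ∘ Pair-comm) λ cb → o-acyclic (bc ++ cb))
    image (no _) (no ¬bc) = addArcᴬ O c≢b ¬H-cb ¬bc

    extension : AcyclicArcs (addPair c b H)
    extension = image Free? (Path? o? b c)

    deleteVertex-o : deleteVertex b o ⇔ deleteVertex b d
    deleteVertex-o = (λ (x≢b , y≢b , r , _) → x≢b , y≢b , r)
                   , (λ (x≢b , y≢b , r) → x≢b , y≢b , r , λ { (inj₁ (_ , y≡b)) → y≢b y≡b
                                                            ; (inj₂ (x≡b , _)) → x≢b x≡b })

    -- In a free orientation the edges at b copy those at a: the only path from b to a is the arc b → a.
    mirror : Free → ∀ {y} → y ≢ a → K b y → (d b y → d a y) × (d a y → d b y)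
    mirror (ba , ¬Path-ba) {y} y≢a by = by⇒ay , ay⇒by
      where
        y≢b : y ≢ b
        y≢b refl = K-irrefl by

        by⇒ay : d b y → d a y
        by⇒ay r with edge⇒arc (N[b]⊆N[a] y y≢a by)
        ... | inj₁ r′ = r′
        ... | inj₂ r′ = ⊥-elim (¬Path-ba ((r , ¬ab₁) ∷ [ r′ , ¬ab₂ ]))
          where
            ¬ab₁ : ¬ Pair a b b y
            ¬ab₁ (inj₁ (b≡a , _)) = a≢b (sym b≡a)
            ¬ab₁ (inj₂ (_ , y≡a)) = y≢a y≡a
            ¬ab₂ : ¬ Pair a b y a
            ¬ab₂ (inj₁ (y≡a , _)) = y≢a y≡a
            ¬ab₂ (inj₂ (y≡b , _)) = y≢b y≡b

        ay⇒by : d a y → d b y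
        ay⇒by r with edge⇒arc by
        ... | inj₁ r′ = r′
        ... | inj₂ r′ = ⊥-elim (acyclic (r ∷ r′ ∷ [ ba ]))

    nonfree-ab : ¬ Free → (d a b → ¬ Path o b a) × (¬ Path o b a → d a b)
    nonfree-ab ¬free = (λ ab p → acyclic (ab ∷ Path-mono proj₁ p)) , ab
      where
        ab : ¬ Path o b a → d a b
        ab ¬p with edge⇒arc ab∈G
        ... | inj₁ r = r
        ... | inj₂ r = ⊥-elim (¬free (r , ¬p))

  ¬arc-bc : (O : AcyclicArcs H) → ¬ AcyclicArcs.arc O b c
  ¬arc-bc O = ¬H-bc ∘ AcyclicArcs.arc⇒edge O

  ¬arc-cb : (O : AcyclicArcs H) → ¬ AcyclicArcs.arc O c b
  ¬arc-cb O = ¬H-cb (inj₁ (refl , refl)) ∘ AcyclicArcs.arc⇒edge O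

  module Compare (D₁ D₂ : AcyclicArcs K) where
    module E₁ = Extension D₁
    module E₂ = Extension D₂
    open AcyclicArcs D₁ using () renaming (arc to d₁; arc⇒edge to d₁⇒K)
    open AcyclicArcs D₂ using () renaming (arc to d₂)

    free-row : E₁.Free → E₂.Free → deleteVertex b d₁ ⇒ deleteVertex b d₂ → ∀ {y} → d₁ b y → d₂ b y
    free-row free₁ free₂ off {y} r with y ≟ a
    ... | yes refl = proj₁ free₂
    ... | no y≢a   = proj₂ (E₂.mirror free₂ y≢a by) (proj₂ (proj₂ (off (a≢b , y≢b , ay))))
      where
        by = d₁⇒K r
        ay = proj₁ (E₁.mirror free₁ y≢a by) r
        y≢b : y ≢ b
        y≢b refl = K-irrefl by

    nonfree-ab : ¬ E₁.Free → ¬ E₂.Free → E₂.o ⇒ E₁.o → d₁ a b → d₂ a b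
    nonfree-ab ¬free₁ ¬free₂ o₂⇒o₁ ab =
      proj₂ (E₂.nonfree-ab ¬free₂) (proj₁ (E₁.nonfree-ab ¬free₁) ab ∘ Path-mono o₂⇒o₁)

    reroute-off-b : E₁.R.reroute ⇒ E₂.R.reroute → deleteVertex b d₁ ⇒ deleteVertex b d₂
    reroute-off-b incl r =
      proj₁ E₂.deleteVertex-o (proj₁ E₂.R.deleteVertex-reroute
        (deleteVertex-mono {R = E₁.R.reroute} {S = E₂.R.reroute} incl
          (proj₂ E₁.R.deleteVertex-reroute (proj₂ E₁.deleteVertex-o r))))

    free-vs-nonfree : (free₁ : E₁.Free) (¬free₂ : ¬ E₂.Free) → ∀ p₁ p₂
                    → ¬ (AcyclicArcs.arc (E₂.image (no ¬free₂) p₂) ⇒ AcyclicArcs.arc (E₁.image (yes free₁) p₁))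
    free-vs-nonfree free₁ ¬free₂ p₁ (yes bc) incl =
      E₁.¬Path-b-c (Path-mono (addArc-cancel (¬arc-bc E₂.O) incl) bc)
    free-vs-nonfree free₁ ¬free₂ p₁ (no _) incl =
      addArc-reversed c≢b (¬arc-cb E₁.Rerouted) incl

  module _ (D₁ D₂ : AcyclicArcs K) where
    private
      module E₁ = Extension D₁
      module E₂ = Extension D₂
      module C₁₂ = Compare D₁ D₂
      module C₂₁ = Compare D₂ D₁
      O₁ = AcyclicArcs.isOrientation D₁
      O₂ = AcyclicArcs.isOrientation D₂

    nonfree-determined : ¬ E₁.Free → ¬ E₂.Free → E₁.o ⇔ E₂.o → AcyclicArcs.arc D₁ ⇔ AcyclicArcs.arc D₂
    nonfree-determined ¬free₁ ¬free₂ (o₁⇒o₂ , o₂⇒o₁) =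
      agree-off-pair O₁ O₂ (o₁⇒o₂ , o₂⇒o₁) (C₁₂.nonfree-ab ¬free₁ ¬free₂ o₂⇒o₁) (C₂₁.nonfree-ab ¬free₂ ¬free₁ o₁⇒o₂)

    image-injective : ∀ f₁ p₁ f₂ p₂
                    → AcyclicArcs.arc (E₁.image f₁ p₁) ⇔ AcyclicArcs.arc (E₂.image f₂ p₂)
                    → AcyclicArcs.arc D₁ ⇔ AcyclicArcs.arc D₂
    image-injective (yes free₁) _ (yes free₂) _ (to , from) =
      agree-off-vertex O₁ O₂ (off₁₂ , off₂₁) (C₁₂.free-row free₁ free₂ off₁₂) (C₂₁.free-row free₂ free₁ off₂₁)
      where
        off₁₂ = C₁₂.reroute-off-b (addArc-cancel (¬arc-bc E₁.Rerouted) to)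
        off₂₁ = C₂₁.reroute-off-b (addArc-cancel (¬arc-bc E₂.Rerouted) from)
    image-injective (yes free₁) p₁ (no ¬free₂) p₂ (_ , from) = ⊥-elim (C₁₂.free-vs-nonfree free₁ ¬free₂ p₁ p₂ from)
    image-injective (no ¬free₁) p₁ (yes free₂) p₂ (to , _)   = ⊥-elim (C₂₁.free-vs-nonfree free₂ ¬free₁ p₂ p₁ to)
    image-injective (no ¬free₁) (yes _) (no ¬free₂) (yes _) (to , from) =
      nonfree-determined ¬free₁ ¬free₂ (addArc-cancel (¬arc-bc E₁.O) to , addArc-cancel (¬arc-bc E₂.O) from)
    image-injective (no ¬free₁) (no _) (no ¬free₂) (no _) (to , from) =
      nonfree-determined ¬free₁ ¬free₂ (addArc-cancel (¬arc-cb E₁.O) to , addArc-cancel (¬arc-cb E₂.O) from)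
    image-injective (no _) (yes _) (no _) (no _) (to , _) = ⊥-elim (addArc-reversed b≢c (¬arc-bc E₂.O) to)
    image-injective (no _) (no _) (no _) (yes _) (to , _) = ⊥-elim (addArc-reversed c≢b (¬arc-cb E₂.O) to)

    extension-injective : AcyclicArcs.arc E₁.extension ⇔ AcyclicArcs.arc E₂.extension
                        → AcyclicArcs.arc D₁ ⇔ AcyclicArcs.arc D₂
    extension-injective = image-injective E₁.Free? (Path? E₁.o? b c) E₂.Free? (Path? E₂.o? b c)

  swappedArcs : AcyclicOrientation (adj G) → AcyclicArcs (Edge (swapAdj (adj G) a b c))
  swappedArcs D = AcyclicArcs-resp (swap swapAdj-edges) (Extension.extension (arcs D))

  swapped : AcyclicOrientation (adj G) → AcyclicOrientation (swapAdj (adj G) a b c)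
  swapped = fromArcs ∘ swappedArcs

  swapped-injective : ∀ {D₁ D₂} → swapped D₁ ≡ swapped D₂ → D₁ ≡ D₂
  swapped-injective {D₁} {D₂} eq = AcyclicOrientation-≡
    (extension-injective (arcs D₁) (arcs D₂) (fromArcs-injective {O₁ = swappedArcs D₁} {O₂ = swappedArcs D₂} eq))

lemma7p3 : ∀ {n} (G : SimpleGraph n) (a b c : Fin n)
    → adj G a b ≡ true
    → (∀ x → x ≢ a → adj G b x ≡ true → adj G a x ≡ true)
    → c ≢ b → adj G c b ≡ false
    → (k k′ : ℕ)
    → AcyclicOrientation (adj G) ↔ Fin k
    → AcyclicOrientation (swapAdj (adj G) a b c) ↔ Fin k′
    → k ≤ k′
lemma7p3 G a b c ab∈G N[b]⊆N[a] c≢b cb∉G k k′ count count′ =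
  injective⇒≤ (Injection.injective (↔⇒↣ count′ ↣-∘ (mk↣ swapped-injective ↣-∘ ↔⇒↣ (↔-sym count))))
  where open EdgeSwap G a b c ab∈G N[b]⊆N[a] c≢b cb∉G
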